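{- Shanin's Principle $$\forall X{:}\mathcal P(N)\,\exists Y{:}\mathcal P(N)\,\big(\mathrm{Stab}(Y)\wedge\forall x{:}N\,(x\in X\leftrightarrow\exists y{:}N\,\langle y,x\rangle\in Y)\big)$$ does not hold in ${\sf RT}(\mathcal S)$, nor in ${\sf RT}(\mathcal K_2)$.
   Context: $\mathcal S$ is Scott's graph model (the combinatory algebra on $\mathcal P(\mathbb N)$ with application $UV=\{n\mid \exists m\,(e_m\subseteq V\wedge\langle m,n\rangle\in U)\}$), and $\mathcal K_2$ is Kleene's second model (the partial combinatory algebra of function realizability on Baire space $\mathbb N^{\mathbb N}$). ${\sf RT}(A)$ denotes the realizability topos over a pca $A$, $N$ its natural numbers object, $\mathcal P(N)$ the power object of $N$, $\langle\cdot,\cdot\rangle$ a definable coding of pairs $N\times N\to N$, and $\mathrm{Stab}(Y)$ abbreviates $\forall x{:}N(\neg\neg(x\in Y)\to x\in Y)$. -}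

module Defs where

open import Level using (Level; Lift; 0ℓ) renaming (suc to lsuc)
open import Data.Nat using (ℕ; zero; suc; _+_; _*_; _<_; ⌊_/2⌋)
open import Data.Nat.DivMod using (_%_)
open import Data.List using (List; []; _∷_; _++_; [_])
open import Data.Product using (Σ; _×_; _,_)
open import Data.Empty using (⊥)
open import Relation.Binary.PropositionalEquality using (_≡_)

-- Cantor pairing  ⟨y , x⟩ = (y+x)(y+x+1)/2 + x  (a recursive bijection
-- ℕ × ℕ → ℕ; used both as the definable pairing in RT(A) and as the
-- pairing in the definition of Scott's application).

tri : ℕ → ℕ
tri zero    = 0
tri (suc n) = suc n + tri n

pair : ℕ → ℕ → ℕ
pair y x = tri (y + x) + x

-- A (concrete presentation of a) pca, enough to interpret the formula
-- in the realizability topos.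
--   App a b c : "a·b is defined and equals c"
--   num n     : the realizer of the numeral n (realizer of E(n) in N)
--   fst, snd  : the projections of the native pairing of realizers

record Model (ℓ : Level) : Set (lsuc ℓ) where
  field
    A    : Set ℓ
    _≈_  : A → A → Set ℓ
    App  : A → A → A → Set ℓ
    num  : ℕ → A
    fst  : A → A
    snd  : A → A

module Realizability {ℓ : Level} (M : Model ℓ) where
  open Model M

  record Pred : Set (lsuc ℓ) where
    field
      mem  : A → Set ℓ
      resp : ∀ {a b} → a ≈ b → mem a → mem b
  open Pred public

  Real : Set (lsuc ℓ)
  Real = A → Set ℓ

  _·_∈_ : A → A → Real → Set ℓ
  a · b ∈ P = Σ A λ c → App a b c × P c

  ⊥R : Real
  ⊥R _ = Lift ℓ ⊥

  _⇒_ : Real → Real → Real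
  (P ⇒ Q) a = ∀ b → P b → a · b ∈ Q

  _∧_ : Real → Real → Real
  (P ∧ Q) a = P (fst a) × Q (snd a)

  ¬R : Real → Real
  ¬R P = P ⇒ ⊥R

  _⇔_ : Real → Real → Real
  P ⇔ Q = (P ⇒ Q) ∧ (Q ⇒ P)

  ∀N : (ℕ → Real) → Real
  ∀N φ a = ∀ n → a · num n ∈ φ n

  ∃N : (ℕ → Real) → Real
  ∃N φ a = Σ ℕ λ n → (fst a ≈ num n) × φ n (snd a)

  -- elements of P(N): (uniform presentation) maps ℕ → P(A);
  -- x ∈ X at numeral n is realized by the elements of X n.
  SubN : Set (lsuc ℓ)
  SubN = ℕ → Pred

  Stab : SubN → Real
  Stab Y = ∀N λ x → ¬R (¬R (mem (Y x))) ⇒ mem (Y x)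

  ShaninBody : SubN → SubN → Real
  ShaninBody X Y =
    Stab Y ∧ ∀N (λ x → mem (X x) ⇔ ∃N (λ y → mem (Y (pair y x))))

  -- r realizes  ∀X:P(N) ∃Y:P(N) (Stab(Y) ∧ ∀x (x∈X ↔ ∃y ⟨y,x⟩∈Y))
  -- (P(N) is uniform, so ∀X / ∃Y are intersection / union)
  ShaninRealizer : A → Set (lsuc ℓ)
  ShaninRealizer r = (X : SubN) → Σ SubN λ Y → ShaninBody X Y r

  -- the principle holds in RT(M) iff it has a realizer
  ShaninHolds : Set (lsuc ℓ)
  ShaninHolds = Σ A ShaninRealizer

shiftR : ℕ → ℕ → ℕ
shiftR zero    m = m
shiftR (suc k) m = shiftR k ⌊ m /2⌋

-- k ∈ e_m  iff  the k-th binary digit of m is 1 (standard enumeration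
-- of finite sets)
_∈e_ : ℕ → ℕ → Set
k ∈e m = shiftR k m % 2 ≡ 1

ScottApp : (ℕ → Set) → (ℕ → Set) → (ℕ → Set) → Set
ScottApp U V W = ∀ n →
  (W n → Σ ℕ λ m → (∀ k → k ∈e m → V k) × U (pair m n)) ×
  ((Σ ℕ λ m → (∀ k → k ∈e m → V k) × U (pair m n)) → W n)

Scott : Model (lsuc 0ℓ)
Scott = record
  { A   = ℕ → Set
  ; _≈_ = λ U V → Lift (lsuc 0ℓ) (∀ n → (U n → V n) × (V n → U n))
  ; App = λ U V W → Lift (lsuc 0ℓ) (ScottApp U V W)
  ; num = λ n k → k ≡ n
  ; fst = λ U n → U (2 * n)
  ; snd = λ U n → U (suc (2 * n))
  }

code : List ℕ → ℕ
code []       = 0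
code (x ∷ xs) = suc (pair x (code xs))

initSeg : (ℕ → ℕ) → ℕ → List ℕ
initSeg β zero    = []
initSeg β (suc k) = initSeg β k ++ [ β k ]

K2App : (ℕ → ℕ) → (ℕ → ℕ) → (ℕ → ℕ) → Set
K2App α β γ = ∀ x → Σ ℕ λ k →
  (∀ j → j < k → α (code (x ∷ initSeg β j)) ≡ 0) ×
  α (code (x ∷ initSeg β k)) ≡ suc (γ x)

K2 : Model 0ℓ
K2 = record
  { A   = ℕ → ℕ
  ; _≈_ = λ α β → ∀ n → α n ≡ β n
  ; App = K2App
  ; num = λ n _ → n
  ; fst = λ α n → α (2 * n)
  ; snd = λ α n → α (suc (2 * n))
  }

-- A realizer of Shanin's principle, applied to the subsets X = N × {β} of N
-- realized only by β, turns β into a number: the forward half of x ∈ X ↔ ∃y ⟨y,x⟩ ∈ Y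
-- extracts some y from β. Since Y is ¬¬-stable, a realizer of ⟨y,0⟩ ∈ Y is produced by
-- the stability realizer from y alone, so the backward half recovers β from y up to ≈.
-- Hence β ↦ y is a realized injection of the realizers into ℕ. No such map exists in
-- Scott's model, where application is monotone (∅ and ℕ get the same number), nor in K₂,
-- where application is continuous (β and any sequence agreeing with it on a long enough
-- prefix get the same number).
module Submission where

open import Defs
open import Data.Product using (_×_)
open import Relation.Nullary using (¬_)

open import Level using (Level; lift; lower)
open import Data.Nat using (ℕ; zero; suc; _*_; _∸_; _<_)
open import Data.Nat.Properties
  using (<-cmp; <-≤-trans; +-suc; n<1+n; ≤-pred; suc-injective; m<n⇒m<1+n; 0≢1+n; m≤n⇒m∸n≡0; m+n∸n≡m)
open import Data.Product using (Σ; _,_; proj₁; proj₂)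
open import Data.Empty using (⊥; ⊥-elim)
open import Data.Unit using (⊤; tt)
open import Data.List using (_∷_; _++_; [_])
open import Function using (id)
open import Relation.Binary using (IsEquivalence; tri<; tri≈; tri>)
open import Relation.Binary.PropositionalEquality using (_≡_; refl; sym; trans; cong; cong₂; subst)
open import Relation.Unary using (_⊆_)

interleave : ∀ {a} {B : Set a} → (ℕ → B) → (ℕ → B) → ℕ → B
interleave f g zero          = f 0
interleave f g (suc zero)    = g 0
interleave f g (suc (suc n)) = interleave (λ i → f (suc i)) (λ i → g (suc i)) n

interleave-even : ∀ {a} {B : Set a} (f g : ℕ → B) n → interleave f g (2 * n) ≡ f n
interleave-even f g zero    = refl
interleave-even f g (suc n) rewrite +-suc n (1 * n) =
  interleave-even (λ i → f (suc i)) (λ i → g (suc i)) n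

interleave-odd : ∀ {a} {B : Set a} (f g : ℕ → B) n → interleave f g (suc (2 * n)) ≡ g n
interleave-odd f g zero    = refl
interleave-odd f g (suc n) rewrite +-suc n (1 * n) =
  interleave-odd (λ i → f (suc i)) (λ i → g (suc i)) n

record ModelLaws {ℓ : Level} (M : Model ℓ) : Set ℓ where
  open Model M
  field
    ≈-isEquivalence : IsEquivalence _≈_
    fst-cong        : ∀ {a b} → a ≈ b → fst a ≈ fst b
    snd-cong        : ∀ {a b} → a ≈ b → snd a ≈ snd b
    App-functional  : ∀ {U V W W'} → App U V W → App U V W' → W ≈ W'
    App-respˡ       : ∀ {U U' V W} → U ≈ U' → App U V W → App U' V W
    pairing         : ∀ n e → Σ A λ p → (fst p ≈ num n) × (snd p ≈ e)

record RealizedInjectionIntoℕ {ℓ : Level} (M : Model ℓ) : Set ℓ where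
  open Model M
  open Realizability M using (_·_∈_)
  field
    encoder         : A
    index           : A → ℕ
    encodes         : ∀ β → encoder · β ∈ (λ w → fst w ≈ num (index β))
    index-injective : ∀ {β β'} → index β ≡ index β' → β ≈ β'

module _ {ℓ : Level} {M : Model ℓ} (laws : ModelLaws M) where
  open Model M
  open Realizability M
  open ModelLaws laws
  open IsEquivalence ≈-isEquivalence using () renaming (refl to ≈-refl; sym to ≈-sym; trans to ≈-trans)

  ¬¬R-intro : ∀ {P : Real} {p} → P p → ∀ b → ¬R (¬R P) b
  ¬¬R-intro p b b' ¬P = ⊥-elim (lower (proj₂ (proj₂ (¬P _ p))))

  singleton : A → SubN
  singleton β _ = record { mem = _≈ β ; resp = λ a≈b a≈β → ≈-trans (≈-sym a≈b) a≈β }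

  module Decoding {r : A} (R : ShaninRealizer r) where
    private
      Y : A → SubN
      Y β = proj₁ (R (singleton β))

      equivalence₀ : ∀ β → snd r · num 0 ∈ ((_≈ β) ⇔ (∃N λ y → mem (Y β (pair y 0))))
      equivalence₀ β = proj₂ (proj₂ (R (singleton β))) 0

      c : A → A
      c β = proj₁ (equivalence₀ β)

      c-unique : ∀ β β' → c β ≈ c β'
      c-unique β β' =
        App-functional (proj₁ (proj₂ (equivalence₀ β))) (proj₁ (proj₂ (equivalence₀ β')))

    common-member : ∀ {β β' m p p'} → mem (Y β m) p → mem (Y β' m) p' →
                    Σ A λ e → mem (Y β m) e × mem (Y β' m) e
    common-member {β} {β'} {m} p∈ p'∈ =
      let (s , r·m , stable) = proj₁ (proj₂ (R (singleton β))) m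
          (s' , r·m' , stable') = proj₁ (proj₂ (R (singleton β'))) m
          (e , s·0 , e∈) = stable (num 0) (¬¬R-intro p∈ (num 0))
          (e' , s'·0 , e'∈) = stable' (num 0) (¬¬R-intro p'∈ (num 0))
          e≈e' = App-functional s·0 (App-respˡ (≈-sym (App-functional r·m r·m')) s'·0)
      in e , e∈ , resp (Y β' m) (≈-sym e≈e') e'∈

    encoder : A
    encoder = fst (c (num 0))

    decoder : A
    decoder = snd (c (num 0))

    encodes : ∀ β → encoder · β ∈ ∃N λ y → mem (Y β (pair y 0))
    encodes β =
      let forward = proj₁ (proj₂ (proj₂ (equivalence₀ β)))
          (w , app , w∈) = forward β ≈-refl
      in w , App-respˡ (fst-cong (c-unique β (num 0))) app , w∈

    decodes : ∀ β y {e} → mem (Y β (pair y 0)) e → decoder · proj₁ (pairing y e) ∈ (_≈ β)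
    decodes β y e∈ =
      let (p , fst≈y , snd≈e) = pairing y _
          backward = proj₂ (proj₂ (proj₂ (equivalence₀ β)))
          (g , app , g≈β) = backward p (y , fst≈y , resp (Y β _) (≈-sym snd≈e) e∈)
      in g , App-respˡ (snd-cong (c-unique β (num 0))) app , g≈β

    index : A → ℕ
    index β = proj₁ (proj₂ (proj₂ (encodes β)))

    index-injective : ∀ {β β'} → index β ≡ index β' → β ≈ β'
    index-injective {β} {β'} eq =
      let (_ , _ , _ , _ , y∈) = encodes β
          (w' , _ , _ , _ , y'∈) = encodes β'
          (_ , e∈ , e∈') = common-member {β} {β'} y∈
                             (subst (λ y → mem (Y β' (pair y 0)) (snd w')) (sym eq) y'∈)
          (g , app , g≈β) = decodes β (index β) e∈
          (g' , app' , g'≈β') = decodes β' (index β) e∈'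
      in ≈-trans (≈-sym g≈β) (≈-trans (App-functional app app') g'≈β')

  shanin⇒injection : ShaninHolds → RealizedInjectionIntoℕ M
  shanin⇒injection (r , R) = record
    { encoder         = encoder
    ; index           = index
    ; encodes         = λ β → let (w , app , _ , fst≈y , _) = encodes β in w , app , fst≈y
    ; index-injective = index-injective
    }
    where open Decoding R

module ScottModel where
  open Model Scott

  ≈⇒⊆ : ∀ {U V} → U ≈ V → U ⊆ V
  ≈⇒⊆ (lift U≈V) = proj₁ (U≈V _)

  ≈⇒⊇ : ∀ {U V} → U ≈ V → V ⊆ U
  ≈⇒⊇ (lift U≈V) = proj₂ (U≈V _)

  ⊆⊇⇒≈ : ∀ {U V} → U ⊆ V → V ⊆ U → U ≈ V
  ⊆⊇⇒≈ U⊆V V⊆U = lift λ n → U⊆V , V⊆U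

  ≡⇒≈ : ∀ {U V} → (∀ n → U n ≡ V n) → U ≈ V
  ≡⇒≈ U≡V = ⊆⊇⇒≈ (λ {n} → subst id (U≡V n)) (λ {n} → subst id (sym (U≡V n)))

  ScottApp-mono : ∀ {U U' V V' W W'} → U ⊆ U' → V ⊆ V' →
                  ScottApp U V W → ScottApp U' V' W' → W ⊆ W'
  ScottApp-mono U⊆U' V⊆V' UV=W U'V'=W' {n} w =
    let (m , em⊆V , u) = proj₁ (UV=W n) w
    in proj₂ (U'V'=W' n) (m , (λ k k∈em → V⊆V' (em⊆V k k∈em)) , U⊆U' u)

  ScottApp-respˡ : ∀ {U U' V W} → U ≈ U' → ScottApp U V W → ScottApp U' V W
  ScottApp-respˡ U≈U' UV=W n =
    (λ w → let (m , em⊆V , u) = proj₁ (UV=W n) w in m , em⊆V , ≈⇒⊆ U≈U' u) ,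
    (λ (m , em⊆V , u') → proj₂ (UV=W n) (m , em⊆V , ≈⇒⊇ U≈U' u'))

  ScottApp-functional : ∀ {U V W W'} → ScottApp U V W → ScottApp U V W' → W ≈ W'
  ScottApp-functional {U} {V} h h' =
    ⊆⊇⇒≈ (ScottApp-mono {U} {U} {V} {V} id id h h') (ScottApp-mono {U} {U} {V} {V} id id h' h)

  laws : ModelLaws Scott
  laws = record
    { ≈-isEquivalence = record
      { refl  = ⊆⊇⇒≈ id id
      ; sym   = λ U≈V → ⊆⊇⇒≈ (≈⇒⊇ U≈V) (≈⇒⊆ U≈V)
      ; trans = λ U≈V V≈W →
          ⊆⊇⇒≈ (λ u → ≈⇒⊆ V≈W (≈⇒⊆ U≈V u)) (λ w → ≈⇒⊇ U≈V (≈⇒⊇ V≈W w))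
      }
    ; fst-cong       = λ (lift U≈V) → lift λ n → U≈V (2 * n)
    ; snd-cong       = λ (lift U≈V) → lift λ n → U≈V (suc (2 * n))
    ; App-functional = λ {U} (lift h) (lift h') → ScottApp-functional {U} h h'
    ; App-respˡ      = λ U≈U' (lift h) → lift (ScottApp-respˡ U≈U' h)
    ; pairing        = λ y e →
        interleave (num y) e , ≡⇒≈ (interleave-even (num y) e) , ≡⇒≈ (interleave-odd (num y) e)
    }

  module _ (ι : RealizedInjectionIntoℕ Scott) where
    open RealizedInjectionIntoℕ ι

    ⊆⇒index≡ : ∀ {β β'} → β ⊆ β' → index β ≡ index β'
    ⊆⇒index≡ {β} {β'} β⊆β' =
      let (_ , lift app , lift fst-w≈) = encodes β
          (_ , lift app' , lift fst-w'≈) = encodes β'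
          2y∈w' = ScottApp-mono {encoder} id β⊆β' app app' (proj₂ (fst-w≈ (index β)) refl)
      in proj₁ (fst-w'≈ (index β)) 2y∈w'

  no-injection : ¬ RealizedInjectionIntoℕ Scott
  no-injection ι = ∅≉ℕ (index-injective (⊆⇒index≡ ι {λ _ → ⊥} {λ _ → ⊤} λ ()))
    where
    open RealizedInjectionIntoℕ ι
    ∅≉ℕ : ¬ ((λ _ → ⊥) ≈ (λ _ → ⊤))
    ∅≉ℕ ∅≈ℕ = ≈⇒⊇ ∅≈ℕ {0} tt

Agree : ℕ → (ℕ → ℕ) → (ℕ → ℕ) → Set
Agree k β β' = ∀ i → i < k → β i ≡ β' i

FirstNonzero : (ℕ → ℕ) → ℕ → ℕ → Set
FirstNonzero s k v = (∀ j → j < k → s j ≡ 0) × s k ≡ suc v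

FirstNonzero-agree : ∀ {s s' k k' v v'} → FirstNonzero s k v → FirstNonzero s' k' v' →
                     Agree (suc k) s s' → v ≡ v'
FirstNonzero-agree {s} {s'} {k} {k'} (zeros , sk) (zeros' , sk') s≡s' with <-cmp k k'
... | tri< k<k' _ _ =
  ⊥-elim (0≢1+n (trans (sym (zeros' k k<k')) (trans (sym (s≡s' k (n<1+n k))) sk)))
... | tri≈ _ refl _ = suc-injective (trans (sym sk) (trans (s≡s' k (n<1+n k)) sk'))
... | tri> _ _ k'<k =
  ⊥-elim (0≢1+n (trans (sym (zeros k' k'<k)) (trans (s≡s' k' (m<n⇒m<1+n k'<k)) sk')))

initSeg-cong : ∀ {β β'} k → Agree k β β' → initSeg β k ≡ initSeg β' k
initSeg-cong zero    _      = refl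
initSeg-cong (suc k) β≡β' =
  cong₂ _++_ (initSeg-cong k λ i i<k → β≡β' i (m<n⇒m<1+n i<k)) (cong [_] (β≡β' k (n<1+n k)))

module K2Model where
  open Model K2

  K2App-continuous : ∀ {α β γ} → K2App α β γ → ∀ x → Σ ℕ λ k →
                     ∀ {β' γ'} → Agree k β β' → K2App α β' γ' → γ x ≡ γ' x
  K2App-continuous {α} αβ=γ x =
    let (k , αβ=γ-at-x) = αβ=γ x
    in k , λ {β'} {γ'} β≡β' αβ'=γ' →
      FirstNonzero-agree αβ=γ-at-x (proj₂ (αβ'=γ' x)) λ j j≤k →
        cong (λ l → α (code (x ∷ l)))
             (initSeg-cong j λ i i<j → β≡β' i (<-≤-trans i<j (≤-pred j≤k)))

  laws : ModelLaws K2
  laws = record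
    { ≈-isEquivalence = record
      { refl  = λ _ → refl
      ; sym   = λ α≈β n → sym (α≈β n)
      ; trans = λ α≈β β≈γ n → trans (α≈β n) (β≈γ n)
      }
    ; fst-cong       = λ α≈β n → α≈β (2 * n)
    ; snd-cong       = λ α≈β n → α≈β (suc (2 * n))
    ; App-functional = λ {α} {β} {γ} {γ'} αβ=γ αβ=γ' x →
        proj₂ (K2App-continuous {α} {β} {γ} αβ=γ x) {β} {γ'} (λ _ _ → refl) αβ=γ'
    ; App-respˡ      = λ α≈α' αβ=γ x →
        let (k , zeros , αk) = αβ=γ x
        in k , (λ j j<k → trans (sym (α≈α' _)) (zeros j j<k)) , trans (sym (α≈α' _)) αk
    ; pairing        = λ y e →
        interleave (λ _ → y) e , interleave-even (λ _ → y) e , interleave-odd (λ _ → y) e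
    }

  module _ (ι : RealizedInjectionIntoℕ K2) where
    open RealizedInjectionIntoℕ ι

    index-continuous : ∀ β → Σ ℕ λ k → ∀ β' → Agree k β β' → index β ≡ index β'
    index-continuous β =
      let (w , app , fst-w≈) = encodes β
          (k , w₀-continuous) = K2App-continuous {encoder} {β} {w} app 0
      in k , λ β' β≡β' →
        let (_ , app' , fst-w'≈) = encodes β'
        in trans (sym (fst-w≈ 0)) (trans (w₀-continuous β≡β' app') (fst-w'≈ 0))

  no-injection : ¬ RealizedInjectionIntoℕ K2
  no-injection ι =
    let (k , index-cont) = index-continuous ι zeros
        zeros≈jump = index-injective (index-cont (jumpAt k) (zeros≡jumpAt-below k))
    in 0≢1+n (trans (zeros≈jump k) (m+n∸n≡m 1 k))
    where
    open RealizedInjectionIntoℕ ι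
    zeros : ℕ → ℕ
    zeros _ = 0
    jumpAt : ℕ → ℕ → ℕ
    jumpAt k i = suc i ∸ k
    zeros≡jumpAt-below : ∀ k → Agree k zeros (jumpAt k)
    zeros≡jumpAt-below k i i<k = sym (m≤n⇒m∸n≡0 i<k)

corollary4p9 : ¬ Realizability.ShaninHolds Scott × ¬ Realizability.ShaninHolds K2
corollary4p9 =
  (λ shanin → ScottModel.no-injection (shanin⇒injection ScottModel.laws shanin)) ,
  (λ shanin → K2Model.no-injection (shanin⇒injection K2Model.laws shanin))
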